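{- If $G=(V,E)$ is a DAG of width $k$, then $G$ has at most $2^k$ frontier antichains.
   Context: In a directed graph, a path is a sequence of distinct vertices $v_1,\ldots,v_\ell$ ($\ell\ge1$) with consecutive vertices joined by edges; $u$ reaches $v$ if there is a path from $u$ to $v$ (every vertex reaches itself). An antichain is a set of vertices no one of which reaches a different one; the width of a DAG is the maximum size of an antichain. A set $A$ reaches $v$ if some $u\in A$ reaches $v$. For antichains $A,B$ of the same size, $B$ dominates $A$ if for every $b\in B$, $A$ reaches $b$ (antichains of different sizes are not related). A frontier antichain of $G$ is an antichain that is not dominated by any other antichain of $G$. -}

module Defs where

open import Data.Nat using (ℕ; _≤_)
open import Data.Fin using (Fin)
open import Data.Fin.Subset using (Subset; _∈_; ∣_∣)
open import Data.List using (List; []; _∷_; [_])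
open import Data.List.Relation.Unary.Unique.Propositional using (Unique)
open import Data.Product using (Σ; ∃; _×_)
open import Relation.Binary.PropositionalEquality using (_≡_; _≢_)
open import Relation.Nullary using (¬_)

Graph : ℕ → Set₁
Graph n = Fin n → Fin n → Set

module _ {n : ℕ} (E : Graph n) where

  data IsWalk : Fin n → Fin n → List (Fin n) → Set where
    single : ∀ {u} → IsWalk u u [ u ]
    step   : ∀ {u w v vs} → E u w → IsWalk w v vs → IsWalk u v (u ∷ vs)

  IsPath : Fin n → Fin n → List (Fin n) → Set
  IsPath u v vs = IsWalk u v vs × Unique vs

  Reaches : Fin n → Fin n → Set
  Reaches u v = ∃ λ vs → IsPath u v vs

  -- Acyclic: no edge u → v together with a path back from v to u
  -- (includes the absence of self-loops).
  IsDAG : Set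
  IsDAG = ∀ u v → E u v → ¬ Reaches v u

  IsAntichain : Subset n → Set
  IsAntichain A = ∀ u v → u ∈ A → v ∈ A → u ≢ v → ¬ Reaches u v

  HasWidth : ℕ → Set
  HasWidth k = (Σ (Subset n) λ A → IsAntichain A × ∣ A ∣ ≡ k)
             × (∀ A → IsAntichain A → ∣ A ∣ ≤ k)

  SetReaches : Subset n → Fin n → Set
  SetReaches A v = ∃ λ u → u ∈ A × Reaches u v

  Dominates : Subset n → Subset n → Set
  Dominates B A = ∣ A ∣ ≡ ∣ B ∣ × (∀ b → b ∈ B → SetReaches A b)

  IsFrontier : Subset n → Set
  IsFrontier A = IsAntichain A
               × (∀ B → IsAntichain B → B ≢ A → ¬ Dominates B A)

module Submission where

-- By Dilworth's theorem the vertices can be coloured with k colours so that each colour class is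
-- a chain of the reachability order; an antichain meets every chain at most once.  Two frontier
-- antichains A, A′ meeting the same set of chains coincide: taking on each of those chains the
-- higher of its elements from A and from A′ yields an antichain of the same size dominating both,
-- which by the frontier property equals A and equals A′.  So frontier antichains are determined by
-- a subset of the k chains, and there are at most 2^k of them.  Dilworth's theorem is proved by
-- Galvin's induction, removing a maximal element.

open import Level using (0ℓ)
open import Effect.Monad using (RawMonad)
import Data.Bool.Properties as Bool
open import Data.Nat using (ℕ; zero; suc; _≤_; _<_; _^_; z≤n; s≤s; _≟_; _≤?_)
open import Data.Nat.Properties using (≤-trans; ≤-antisym; ≤-pred; ≤∧≢⇒<; ≤-<-trans; <⇒≱)
open import Data.Fin using (Fin; zero; suc; funToFin; finToFun)
import Data.Fin.Properties as Fin
open import Data.Fin.Properties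
  using (sequence; injective⇒≤; finToFun-funToFin; 2↔Bool; any?; all?) renaming (_≟_ to _≟ᶠ_)
open import Data.Fin.Subset
  using (Subset; _∈_; _∉_; _⊆_; _⊂_; ∣_∣; inside; outside; _-_; _∪_; ⁅_⁆; ⊤; Nonempty)
open import Data.Fin.Subset.Properties
  using ( _∈?_; _⊆?_; nonempty?; anySubset?; ∈⊤; ⊆⊤; ∣p∣≤n; ∣p∣≡n⇒p≡⊤; x∈⁅x⁆; x∈⁅y⁆⇒x≡y; ∣⁅x⁆∣≡1
        ; x∈p∪q⁻; p⊆p∪q; q⊆p∪q; ∪-comm; p⊂q⇒∣p∣<∣q∣; x∈p⇒∣p-x∣<∣p∣; x∈p∧x≢y⇒x∈p-y)
open import Data.Fin.Subset.Induction using (Acc; acc; ⊂-wellFounded)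
open import Data.Product as Product using (Σ; ∃; _×_; _,_; proj₁; proj₂)
open import Data.Sum using (_⊎_; inj₁; inj₂)
open import Data.List using (List; []; _∷_; [_]; length; lookup; allFin)
open import Data.List.Membership.Propositional using () renaming (_∈_ to _∈ₗ_)
open import Data.List.Membership.Propositional.Properties using (∈-lookup; ∈-allFin)
open import Data.List.Relation.Unary.Any as Any using (here; there)
open import Data.List.Relation.Unary.All as All using (All)
open import Data.List.Relation.Unary.All.Properties using (¬Any⇒All¬)
open import Data.List.Relation.Unary.Unique.Propositional using (Unique; []; _∷_)
import Data.Vec as Vec
open import Data.Vec using (tabulate; _∷_; []; here; there)
open import Data.Vec.Properties
  using (≡-dec; lookup∘tabulate; tabulate∘lookup; tabulate-cong; []=⇒lookup; lookup⇒[]=)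
open import Function using (_∘_; Injective; Inverse; Injection)
open import Function.Properties.Inverse using (↔-sym; ↔⇒↣)
open import Relation.Nullary using (¬_; Dec; does; yes; no; contradiction)
open import Relation.Nullary.Negation using (DoubleNegation; ¬¬-Monad; ¬¬-map)
open import Relation.Nullary.Decidable
  using (dec-true; decidable-stable; ¬¬-excluded-middle; map′; _×-dec_; _⊎-dec_; _→-dec_; ¬?)
open import Relation.Unary using (Pred; Decidable)
open import Relation.Binary using (Rel; IsDecPartialOrder)
open import Relation.Binary.Construct.Closure.ReflexiveTransitive using (Star; ε; _◅_; _◅◅_)
import Relation.Binary.Construct.Closure.ReflexiveTransitive.Properties as Star
open import Relation.Binary.PropositionalEquality
  using (_≡_; _≗_; refl; sym; trans; cong; subst; module ≡-Reasoning)

import Defs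

variable
  n m : ℕ

fromDec : ∀ {q} {Q : Pred (Fin n) q} → Decidable Q → Subset n
fromDec Q? = tabulate (does ∘ Q?)

module _ {q} {Q : Pred (Fin n) q} (Q? : Decidable Q) where

  ∈-fromDec⁺ : ∀ {x} → Q x → x ∈ fromDec Q?
  ∈-fromDec⁺ {x} q = lookup⇒[]= x _ (trans (lookup∘tabulate _ x) (dec-true (Q? x) q))

  ∈-fromDec⁻ : ∀ {x} → x ∈ fromDec Q? → Q x
  ∈-fromDec⁻ {x} x∈ with Q? x | trans (sym (lookup∘tabulate _ x)) ([]=⇒lookup x∈)
  ... | yes q | _ = q

injection⇒∣∣≤ : (X : Subset n) (Y : Subset m) (f : ∀ {x} → x ∈ X → Fin m) →
                (∀ {x} (x∈X : x ∈ X) → f x∈X ∈ Y) →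
                (∀ {x y} (x∈X : x ∈ X) (y∈X : y ∈ X) → f x∈X ≡ f y∈X → x ≡ y) →
                ∣ X ∣ ≤ ∣ Y ∣
injection⇒∣∣≤ [] Y f f∈Y f-inj = z≤n
injection⇒∣∣≤ (outside ∷ X) Y f f∈Y f-inj =
  injection⇒∣∣≤ X Y (f ∘ there) (f∈Y ∘ there)
    (λ x∈X y∈X → Fin.suc-injective ∘ f-inj (there x∈X) (there y∈X))
injection⇒∣∣≤ (inside ∷ X) Y f f∈Y f-inj =
  ≤-trans (s≤s (injection⇒∣∣≤ X (Y - f here) (f ∘ there) f∈Y-f₀ f-inj′)) (x∈p⇒∣p-x∣<∣p∣ (f∈Y here))
  where
  f∈Y-f₀ : ∀ {x} (x∈X : x ∈ X) → f (there x∈X) ∈ Y - f here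
  f∈Y-f₀ x∈X = x∈p∧x≢y⇒x∈p-y (f∈Y (there x∈X)) (Fin.0≢1+n ∘ sym ∘ f-inj (there x∈X) here)
  f-inj′ : ∀ {x y} (x∈X : x ∈ X) (y∈X : y ∈ X) → f (there x∈X) ≡ f (there y∈X) → x ≡ y
  f-inj′ x∈X y∈X = Fin.suc-injective ∘ f-inj (there x∈X) (there y∈X)

lookup-injective : ∀ {a} {A : Set a} {xs : List A} → Unique xs → Injective _≡_ _≡_ (lookup xs)
lookup-injective (_    ∷ _)        {zero}  {zero}  _  = refl
lookup-injective (x∉xs ∷ _)        {zero}  {suc j} eq = contradiction eq (All.lookup x∉xs (∈-lookup j))
lookup-injective (x∉xs ∷ _)        {suc i} {zero}  eq =
  contradiction (sym eq) (All.lookup x∉xs (∈-lookup i))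
lookup-injective (_    ∷ distinct) {suc i} {suc j} eq = cong suc (lookup-injective distinct eq)

Unique⇒length≤ : ∀ {a} {A : Set a} {xs : List A} (f : A → Fin m) →
                 (∀ {x y} → x ∈ₗ xs → y ∈ₗ xs → f x ≡ f y → x ≡ y) →
                 Unique xs → length xs ≤ m
Unique⇒length≤ f f-inj u = injective⇒≤ (lookup-injective u ∘ f-inj (∈-lookup _) (∈-lookup _))

funToFin-injective : {f g : Fin m → Fin n} → funToFin f ≡ funToFin g → f ≗ g
funToFin-injective {f = f} {g} eq i = begin
  f i                        ≡⟨ finToFun-funToFin f i ⟨
  finToFun (funToFin f) i    ≡⟨ cong (λ z → finToFun z i) eq ⟩
  finToFun (funToFin g) i    ≡⟨ finToFun-funToFin g i ⟩
  g i                        ∎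
  where open ≡-Reasoning

subsetToFin : Subset m → Fin (2 ^ m)
subsetToFin p = funToFin (Inverse.from 2↔Bool ∘ Vec.lookup p)

subsetToFin-injective : Injective _≡_ _≡_ (subsetToFin {m})
subsetToFin-injective {x = p} {q} eq = begin
  p                       ≡⟨ tabulate∘lookup p ⟨
  tabulate (Vec.lookup p) ≡⟨ tabulate-cong (fromBool-injective ∘ funToFin-injective eq) ⟩
  tabulate (Vec.lookup q) ≡⟨ tabulate∘lookup q ⟩
  q                       ∎
  where
  open ≡-Reasoning
  fromBool-injective : Injective _≡_ _≡_ (Inverse.from 2↔Bool)
  fromBool-injective = Injection.injective (↔⇒↣ (↔-sym 2↔Bool))

∣p∣≡1+k⇒Nonempty : ∀ {k} (p : Subset n) → ∣ p ∣ ≡ suc k → Nonempty p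
∣p∣≡1+k⇒Nonempty (inside  ∷ p) _  = zero , here
∣p∣≡1+k⇒Nonempty (outside ∷ p) eq = Product.map suc there (∣p∣≡1+k⇒Nonempty p eq)

module _ {q} {K : Pred (Fin n) q} (K? : Decidable K) (P : Subset n) where

  ∈∖? : Decidable (λ x → x ∈ P × ¬ K x)
  ∈∖? x = x ∈? P ×-dec ¬? (K? x)

_∖_ : ∀ {q} {K : Pred (Fin n) q} → Subset n → Decidable K → Subset n
P ∖ K? = fromDec (∈∖? K? P)

module _ {q} {K : Pred (Fin n) q} (K? : Decidable K) {P : Subset n} where

  ∈-∖⁺ : ∀ {x} → x ∈ P → ¬ K x → x ∈ P ∖ K?
  ∈-∖⁺ x∈P ¬Kx = ∈-fromDec⁺ (∈∖? K? P) (x∈P , ¬Kx)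

  ∈-∖⁻ : ∀ {x} → x ∈ P ∖ K? → x ∈ P × ¬ K x
  ∈-∖⁻ = ∈-fromDec⁻ (∈∖? K? P)

  ∖⊆ : P ∖ K? ⊆ P
  ∖⊆ = proj₁ ∘ ∈-∖⁻

  ∖⊂ : ∀ {x} → x ∈ P → K x → P ∖ K? ⊂ P
  ∖⊂ {x} x∈P Kx = ∖⊆ , x , x∈P , λ x∈P∖K → proj₂ (∈-∖⁻ x∈P∖K) Kx

module FinitePoset {n} {_≼_ : Rel (Fin n) 0ℓ} (isDecPartialOrder : IsDecPartialOrder _≡_ _≼_) where

  open IsDecPartialOrder isDecPartialOrder
    using (antisym; reflexive) renaming (refl to ≼-refl; trans to ≼-trans; _≤?_ to _≼?_)

  Comparable : Rel (Fin n) 0ℓ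
  Comparable x y = x ≼ y ⊎ y ≼ x

  IsAntichain : Pred (Subset n) 0ℓ
  IsAntichain A = ∀ {x y} → x ∈ A → y ∈ A → x ≼ y → x ≡ y

  antichain? : Decidable IsAntichain
  antichain? A = map′ (λ ac {x} {y} → ac x y) (λ ac x y → ac)
    (all? λ x → all? λ y → x ∈? A →-dec y ∈? A →-dec x ≼? y →-dec x ≟ᶠ y)

  WidthAtMost : Subset n → ℕ → Set
  WidthAtMost P k = ∀ {A} → A ⊆ P → IsAntichain A → ∣ A ∣ ≤ k

  IsChainColouring : ∀ {k} → Subset n → (Fin n → Fin k) → Set
  IsChainColouring P c = ∀ {x y} → x ∈ P → y ∈ P → c x ≡ c y → Comparable x y

  ChainCover : Subset n → ℕ → Set
  ChainCover P k = Σ (Fin n → Fin k) (IsChainColouring P)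

  Maximal : ∀ {q} → Pred (Fin n) q → Pred (Fin n) q
  Maximal Q m = Q m × (∀ {y} → Q y → m ≼ y → y ≡ m)

  module _ {q} {Q : Pred (Fin n) q} (Q? : Decidable Q) where

    maximalAmong : ∀ {x} (xs : List (Fin n)) → Q x →
                   ∃ λ m → Q m × (∀ {y} → y ∈ₗ xs → Q y → m ≼ y → y ≡ m)
    maximalAmong {x} [] qx = x , qx , λ ()
    maximalAmong (z ∷ zs) qx with maximalAmong zs qx
    ... | m , qm , m-max with Q? z ×-dec m ≼? z
    ...   | yes (qz , m≼z) = z , qz , λ
      { (here refl) _ _       → refl
      ; (there y∈zs) qy z≼y →
          let y≡m = m-max y∈zs qy (≼-trans m≼z z≼y)
          in  trans y≡m (antisym m≼z (subst (z ≼_) y≡m z≼y)) }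
    ...   | no ¬qz×m≼z = m , qm , λ
      { (here refl) qy m≼y → contradiction (qy , m≼y) ¬qz×m≼z
      ; (there y∈zs)       → m-max y∈zs }

    maximal-exists : ∃ Q → ∃ (Maximal Q)
    maximal-exists (x , qx) with maximalAmong (allFin n) qx
    ... | m , qm , m-max = m , qm , m-max (∈-allFin _)

  module Colouring {k} {P : Subset n} {c : Fin n → Fin k} (chain : IsChainColouring P c) where

    colour-injective : ∀ {A} → A ⊆ P → IsAntichain A → ∀ {x y} → x ∈ A → y ∈ A → c x ≡ c y → x ≡ y
    colour-injective A⊆P acA x∈A y∈A eq with chain (A⊆P x∈A) (A⊆P y∈A) eq
    ... | inj₁ x≼y = acA x∈A y∈A x≼y
    ... | inj₂ y≼x = sym (acA y∈A x∈A y≼x)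

    HasColour : Subset n → Pred (Fin k) 0ℓ
    HasColour A i = ∃ λ a → a ∈ A × c a ≡ i

    hasColour? : ∀ A → Decidable (HasColour A)
    hasColour? A i = any? λ a → a ∈? A ×-dec c a ≟ᶠ i

    colours : Subset n → Subset k
    colours A = fromDec (hasColour? A)

    ∈-colours⁺ : ∀ {A a} → a ∈ A → c a ∈ colours A
    ∈-colours⁺ {A} a∈A = ∈-fromDec⁺ (hasColour? A) (_ , a∈A , refl)

    ∈-colours⁻ : ∀ {A i} → i ∈ colours A → HasColour A i
    ∈-colours⁻ {A} = ∈-fromDec⁻ (hasColour? A)

    colours-mono : ∀ {A B} → A ⊆ B → colours A ⊆ colours B
    colours-mono A⊆B i∈ with ∈-colours⁻ i∈
    ... | a , a∈A , refl = ∈-colours⁺ (A⊆B a∈A)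

    colours⊆⇒∣∣≤ : ∀ {A B} → A ⊆ P → IsAntichain A → colours A ⊆ colours B → ∣ A ∣ ≤ ∣ B ∣
    colours⊆⇒∣∣≤ {A} {B} A⊆P acA sub = injection⇒∣∣≤ A B (proj₁ ∘ partner) (proj₁ ∘ proj₂ ∘ partner)
      λ x∈A y∈A eq → colour-injective A⊆P acA x∈A y∈A (begin
        c _                     ≡⟨ proj₂ (proj₂ (partner x∈A)) ⟨
        c (proj₁ (partner x∈A)) ≡⟨ cong c eq ⟩
        c (proj₁ (partner y∈A)) ≡⟨ proj₂ (proj₂ (partner y∈A)) ⟩
        c _                     ∎)
      where
      open ≡-Reasoning
      partner : ∀ {a} → a ∈ A → HasColour B (c a)
      partner = ∈-colours⁻ ∘ sub ∘ ∈-colours⁺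

    ∣∣≤∣colours∣ : ∀ {A} → A ⊆ P → IsAntichain A → ∣ A ∣ ≤ ∣ colours A ∣
    ∣∣≤∣colours∣ {A} A⊆P acA =
      injection⇒∣∣≤ A (colours A) (λ {a} _ → c a) ∈-colours⁺ (colour-injective A⊆P acA)

    ∣∣≡k⇒colours≡⊤ : ∀ {A} → A ⊆ P → IsAntichain A → ∣ A ∣ ≡ k → colours A ≡ ⊤
    ∣∣≡k⇒colours≡⊤ {A} A⊆P acA ∣A∣≡k = ∣p∣≡n⇒p≡⊤
      (≤-antisym (∣p∣≤n (colours A)) (subst (_≤ ∣ colours A ∣) ∣A∣≡k (∣∣≤∣colours∣ A⊆P acA)))

    IsTopIn : Subset n → Pred (Fin n) 0ℓ
    IsTopIn U t = t ∈ U × (∀ {u} → u ∈ U → c u ≡ c t → u ≼ t)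

    isTopIn? : ∀ U → Decidable (IsTopIn U)
    isTopIn? U t = t ∈? U ×-dec map′ (λ h {u} → h u) (λ h u → h)
      (all? λ u → u ∈? U →-dec c u ≟ᶠ c t →-dec u ≼? t)

    tops : Subset n → Subset n
    tops U = fromDec (isTopIn? U)

    ∈-tops⁺ : ∀ {U t} → IsTopIn U t → t ∈ tops U
    ∈-tops⁺ {U} = ∈-fromDec⁺ (isTopIn? U)

    ∈-tops⁻ : ∀ {U t} → t ∈ tops U → IsTopIn U t
    ∈-tops⁻ {U} = ∈-fromDec⁻ (isTopIn? U)

    tops⊆ : ∀ {U} → tops U ⊆ U
    tops⊆ = proj₁ ∘ ∈-tops⁻

    ≼-top : ∀ {U u t} → u ∈ U → t ∈ tops U → c u ≡ c t → u ≼ t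
    ≼-top u∈U t∈T = proj₂ (∈-tops⁻ t∈T) u∈U

    tops-colour-injective : ∀ {U x y} → x ∈ tops U → y ∈ tops U → c x ≡ c y → x ≡ y
    tops-colour-injective x∈T y∈T eq = antisym (≼-top (tops⊆ x∈T) y∈T eq) (≼-top (tops⊆ y∈T) x∈T (sym eq))

    colours-tops : ∀ {U} → U ⊆ P → colours U ⊆ colours (tops U)
    colours-tops {U} U⊆P i∈ with ∈-colours⁻ i∈
    ... | u , u∈U , refl with maximal-exists (λ w → w ∈? U ×-dec c w ≟ᶠ c u) (u , u∈U , refl)
    ... | m , (m∈U , cm≡cu) , m-max =
      subst (_∈ colours (tops U)) cm≡cu (∈-colours⁺ (∈-tops⁺ (m∈U , ≼m)))
      where
      ≼m : ∀ {w} → w ∈ U → c w ≡ c m → w ≼ m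
      ≼m w∈U cw≡cm with chain (U⊆P w∈U) (U⊆P m∈U) cw≡cm
      ... | inj₁ w≼m = w≼m
      ... | inj₂ m≼w = reflexive (m-max (w∈U , trans cw≡cm cm≡cu) m≼w)

    CoveredByFullAntichains : Subset n → Set
    CoveredByFullAntichains U =
      ∀ {y} → y ∈ U → ∃ λ V → y ∈ V × V ⊆ U × IsAntichain V × colours U ⊆ colours V

    tops-antichain : ∀ {U} → CoveredByFullAntichains U → IsAntichain (tops U)
    tops-antichain full {x} {y} x∈T y∈T x≼y with full (tops⊆ y∈T)
    ... | V , y∈V , V⊆U , acV , colsU⊆colsV with ∈-colours⁻ (colsU⊆colsV (∈-colours⁺ (tops⊆ x∈T)))
    ... | u , u∈V , cu≡cx = tops-colour-injective x∈T y∈T (begin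
      c x ≡⟨ cu≡cx ⟨
      c u ≡⟨ cong c (acV u∈V y∈V (≼-trans (≼-top (V⊆U u∈V) x∈T cu≡cx) x≼y)) ⟩
      c y ∎)
      where open ≡-Reasoning

  module _ {q} {K : Pred (Fin n) q} (K? : Decidable K)
           (K-chain : ∀ {x y} → K x → K y → Comparable x y) {P : Subset n} where

    chainCover-extend : ∀ {k} → (Nonempty (P ∖ K?) → ChainCover (P ∖ K?) k) → ChainCover P (suc k)
    chainCover-extend {k} cover with nonempty? (P ∖ K?)
    ... | no P∖K-empty = (λ _ → zero) , λ x∈P y∈P _ → K-chain (∈K x∈P) (∈K y∈P)
      where
      ∈K : ∀ {x} → x ∈ P → K x
      ∈K {x} x∈P = decidable-stable (K? x) (λ ¬Kx → P∖K-empty (x , ∈-∖⁺ K? x∈P ¬Kx))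
    ... | yes P∖K-nonempty with cover P∖K-nonempty
    ... | c , chain = c⁺ , chain⁺
      where
      c⁺ : Fin n → Fin (suc k)
      c⁺ x with K? x
      ... | yes _ = zero
      ... | no  _ = suc (c x)
      chain⁺ : IsChainColouring P c⁺
      chain⁺ {x} {y} x∈P y∈P eq with K? x | K? y
      ... | yes Kx  | yes Ky  = K-chain Kx Ky
      ... | no ¬Kx  | no ¬Ky  = chain (∈-∖⁺ K? x∈P ¬Kx) (∈-∖⁺ K? y∈P ¬Ky) (Fin.suc-injective eq)

  IsAntichainOfSize : Subset n → ℕ → Pred (Subset n) 0ℓ
  IsAntichainOfSize Q k Y = Y ⊆ Q × IsAntichain Y × ∣ Y ∣ ≡ k

  isAntichainOfSize? : ∀ Q k → Decidable (IsAntichainOfSize Q k)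
  isAntichainOfSize? Q k Y = Y ⊆? Q ×-dec antichain? Y ×-dec ∣ Y ∣ ≟ k

  WidthAtMost-mono : ∀ {P Q k} → Q ⊆ P → WidthAtMost P k → WidthAtMost Q k
  WidthAtMost-mono Q⊆P width A⊆Q = width (Q⊆P ∘ A⊆Q)

  WidthAtMost-pred : ∀ {P k} → WidthAtMost P (suc k) → (∀ {A} → ¬ IsAntichainOfSize P (suc k) A) →
                     WidthAtMost P k
  WidthAtMost-pred width none A⊆P acA = ≤-pred (≤∧≢⇒< (width A⊆P acA) (λ eq → none (A⊆P , acA , eq)))

  ⁅⁆-antichain : ∀ x → IsAntichain ⁅ x ⁆
  ⁅⁆-antichain x u∈ v∈ _ = trans (x∈⁅y⁆⇒x≡y x u∈) (sym (x∈⁅y⁆⇒x≡y x v∈))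

  -- Let a be maximal in P and P′ = P without a.  If P′ has no antichain of size k + 1,
  -- a gets a colour of its own.  Otherwise, in a colouring of P′, the highest element of each chain
  -- lying in some maximum antichain of P′ gives an antichain T using every colour.  As T ∪ ⁅ a ⁆ is
  -- too wide, some t ∈ T lies below a; the chain K of a and the elements of t's chain below t meets
  -- every maximum antichain of P′, so P ∖ K has width at most k.
  module DilworthStep {P : Subset n} {k : ℕ} {a : Fin n} (a-max : Maximal (_∈ P) a)
           (width : WidthAtMost P (suc k))
           (cover : ∀ {Q k} → Q ⊂ P → Nonempty Q → WidthAtMost Q k → ChainCover Q k) where

    P′ : Subset n
    P′ = P ∖ (_≟ᶠ a)

    P′⊂P : P′ ⊂ P
    P′⊂P = ∖⊂ (_≟ᶠ a) (proj₁ a-max) refl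

    module WithMaximumAntichain {Y₀} (Y₀-max : IsAntichainOfSize P′ (suc k) Y₀) where

      cover′ : ChainCover P′ (suc k)
      cover′ = cover P′⊂P
        (Product.map₂ (proj₁ Y₀-max) (∣p∣≡1+k⇒Nonempty Y₀ (proj₂ (proj₂ Y₀-max))))
        (WidthAtMost-mono (∖⊆ (_≟ᶠ a)) width)

      c′ : Fin n → Fin (suc k)
      c′ = proj₁ cover′

      open Colouring (proj₂ cover′)

      InMaximumAntichain : Pred (Fin n) 0ℓ
      InMaximumAntichain x = ∃ λ Y → IsAntichainOfSize P′ (suc k) Y × x ∈ Y

      inMaximumAntichain? : Decidable InMaximumAntichain
      inMaximumAntichain? x = anySubset? λ Y → isAntichainOfSize? P′ (suc k) Y ×-dec x ∈? Y

      G : Subset n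
      G = fromDec inMaximumAntichain?

      G⊆P′ : G ⊆ P′
      G⊆P′ x∈G with ∈-fromDec⁻ inMaximumAntichain? x∈G
      ... | _ , (Y⊆P′ , _) , x∈Y = Y⊆P′ x∈Y

      maximum⊆G : ∀ {Y} → IsAntichainOfSize P′ (suc k) Y → Y ⊆ G
      maximum⊆G Y-max y∈Y = ∈-fromDec⁺ inMaximumAntichain? (_ , Y-max , y∈Y)

      all-colours : ∀ {Y} → IsAntichainOfSize P′ (suc k) Y → ∀ i → i ∈ colours Y
      all-colours (Y⊆P′ , acY , ∣Y∣≡1+k) i = subst (i ∈_) (sym (∣∣≡k⇒colours≡⊤ Y⊆P′ acY ∣Y∣≡1+k)) ∈⊤

      G-covered : CoveredByFullAntichains G
      G-covered y∈G with ∈-fromDec⁻ inMaximumAntichain? y∈G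
      ... | Y , Y-max@(_ , acY , _) , y∈Y = Y , y∈Y , maximum⊆G Y-max , acY , λ _ → all-colours Y-max _

      T : Subset n
      T = tops G

      T⊆P′ : T ⊆ P′
      T⊆P′ = G⊆P′ ∘ tops⊆

      T-antichain : IsAntichain T
      T-antichain = tops-antichain G-covered

      ∣T∣≥1+k : suc k ≤ ∣ T ∣
      ∣T∣≥1+k = subst (_≤ ∣ T ∣) (proj₂ (proj₂ Y₀-max))
        (colours⊆⇒∣∣≤ (proj₁ Y₀-max) (proj₁ (proj₂ Y₀-max))
          (colours-tops G⊆P′ ∘ colours-mono (maximum⊆G Y₀-max)))

      a∉T : a ∉ T
      a∉T a∈T = proj₂ (∈-∖⁻ (_≟ᶠ a) (T⊆P′ a∈T)) refl

      T∪a-antichain : (∀ {x} → x ∈ T → ¬ Comparable x a) → IsAntichain (T ∪ ⁅ a ⁆)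
      T∪a-antichain incomparable {x} {y} x∈Z y∈Z x≼y with x∈p∪q⁻ T ⁅ a ⁆ x∈Z | x∈p∪q⁻ T ⁅ a ⁆ y∈Z
      ... | inj₁ x∈T | inj₁ y∈T = T-antichain x∈T y∈T x≼y
      ... | inj₂ x∈a | inj₂ y∈a = ⁅⁆-antichain a x∈a y∈a x≼y
      ... | inj₁ x∈T | inj₂ y∈a =
        contradiction (inj₁ (subst (x ≼_) (x∈⁅y⁆⇒x≡y a y∈a) x≼y)) (incomparable x∈T)
      ... | inj₂ x∈a | inj₁ y∈T =
        contradiction (inj₂ (subst (_≼ y) (x∈⁅y⁆⇒x≡y a x∈a) x≼y)) (incomparable y∈T)

      top-below-a : ∃ λ x → x ∈ T × x ≼ a
      top-below-a with any? (λ x → x ∈? T ×-dec (x ≼? a ⊎-dec a ≼? x))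
      ... | yes (x , x∈T , inj₁ x≼a) = x , x∈T , x≼a
      ... | yes (x , x∈T , inj₂ a≼x) = x , x∈T , reflexive (proj₂ a-max (∖⊆ (_≟ᶠ a) (T⊆P′ x∈T)) a≼x)
      ... | no none = contradiction (width T∪a⊆P (T∪a-antichain λ x∈T x~a → none (_ , x∈T , x~a)))
                                    (<⇒≱ (≤-<-trans ∣T∣≥1+k ∣T∣<∣T∪a∣))
        where
        T∪a⊆P : T ∪ ⁅ a ⁆ ⊆ P
        T∪a⊆P x∈Z with x∈p∪q⁻ T ⁅ a ⁆ x∈Z
        ... | inj₁ x∈T = ∖⊆ (_≟ᶠ a) (T⊆P′ x∈T)
        ... | inj₂ x∈a = subst (_∈ P) (sym (x∈⁅y⁆⇒x≡y a x∈a)) (proj₁ a-max)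
        ∣T∣<∣T∪a∣ : ∣ T ∣ < ∣ T ∪ ⁅ a ⁆ ∣
        ∣T∣<∣T∪a∣ = p⊂q⇒∣p∣<∣q∣ (p⊆p∪q ⁅ a ⁆ , a , q⊆p∪q T ⁅ a ⁆ (x∈⁅x⁆ a) , a∉T)

      module BelowA {t} (t∈T : t ∈ T) (t≼a : t ≼ a) where

        K : Pred (Fin n) 0ℓ
        K q = q ≡ a ⊎ (q ∈ P′ × c′ q ≡ c′ t × q ≼ t)

        K? : Decidable K
        K? q = q ≟ᶠ a ⊎-dec (q ∈? P′ ×-dec c′ q ≟ᶠ c′ t ×-dec q ≼? t)

        K-chain : ∀ {x y} → K x → K y → Comparable x y
        K-chain (inj₁ refl)             (inj₁ refl)             = inj₁ ≼-refl
        K-chain (inj₁ refl)             (inj₂ (_ , _ , y≼t))    = inj₂ (≼-trans y≼t t≼a)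
        K-chain (inj₂ (_ , _ , x≼t))    (inj₁ refl)             = inj₁ (≼-trans x≼t t≼a)
        K-chain (inj₂ (x∈P′ , cx , _)) (inj₂ (y∈P′ , cy , _)) = proj₂ cover′ x∈P′ y∈P′ (trans cx (sym cy))

        P∖K⊆P′ : P ∖ K? ⊆ P′
        P∖K⊆P′ x∈P∖K with ∈-∖⁻ K? x∈P∖K
        ... | x∈P , ¬Kx = ∈-∖⁺ (_≟ᶠ a) x∈P (¬Kx ∘ inj₁)

        maximum-antichain-meets-K : ∀ {A} → IsAntichainOfSize P′ (suc k) A → ∃ λ z → z ∈ A × K z
        maximum-antichain-meets-K A-max@(A⊆P′ , _) =
          let z , z∈A , cz≡ct = ∈-colours⁻ (all-colours A-max (c′ t))
          in  z , z∈A , inj₂ (A⊆P′ z∈A , cz≡ct , ≼-top (maximum⊆G A-max z∈A) t∈T cz≡ct)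

        no-maximum-antichain-avoids-K : ∀ {A} → ¬ IsAntichainOfSize (P ∖ K?) (suc k) A
        no-maximum-antichain-avoids-K (A⊆P∖K , acA , ∣A∣) =
          let z , z∈A , Kz = maximum-antichain-meets-K ((λ x∈A → P∖K⊆P′ (A⊆P∖K x∈A)) , acA , ∣A∣)
          in  proj₂ (∈-∖⁻ K? (A⊆P∖K z∈A)) Kz

        chainCover : ChainCover P (suc k)
        chainCover = chainCover-extend K? K-chain λ P∖K-nonempty →
          cover (∖⊂ K? (proj₁ a-max) (inj₁ refl)) P∖K-nonempty
                (WidthAtMost-pred (WidthAtMost-mono (∖⊆ K?) width) no-maximum-antichain-avoids-K)

      chainCover : ChainCover P (suc k)
      chainCover = BelowA.chainCover (proj₁ (proj₂ top-below-a)) (proj₂ (proj₂ top-below-a))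

    chainCover : ChainCover P (suc k)
    chainCover with anySubset? (isAntichainOfSize? P′ (suc k))
    ... | yes (_ , Y₀-max) = WithMaximumAntichain.chainCover Y₀-max
    ... | no none = chainCover-extend (_≟ᶠ a) (λ { refl refl → inj₁ ≼-refl }) λ P′-nonempty →
      cover P′⊂P P′-nonempty
            (WidthAtMost-pred (WidthAtMost-mono (∖⊆ (_≟ᶠ a)) width) (λ Y-max → none (_ , Y-max)))

  dilworth-nonempty : ∀ {P k} → Acc _⊂_ P → Nonempty P → WidthAtMost P k → ChainCover P k
  dilworth-nonempty {P} {zero} _ (x , x∈P) width =
    contradiction (subst (_≤ 0) (∣⁅x⁆∣≡1 x) (width ⁅x⁆⊆P (⁅⁆-antichain x))) λ ()
    where
    ⁅x⁆⊆P : ⁅ x ⁆ ⊆ P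
    ⁅x⁆⊆P y∈⁅x⁆ = subst (_∈ P) (sym (x∈⁅y⁆⇒x≡y x y∈⁅x⁆)) x∈P
  dilworth-nonempty {P} {suc k} (acc rs) P-nonempty width
    with a-max ← proj₂ (maximal-exists (_∈? P) P-nonempty) =
    DilworthStep.chainCover a-max width (λ Q⊂P → dilworth-nonempty (rs Q⊂P))

  dilworth : ∀ {k} → WidthAtMost ⊤ k → ChainCover ⊤ k
  dilworth width with nonempty? ⊤
  ... | yes ⊤-nonempty = dilworth-nonempty (⊂-wellFounded ⊤) ⊤-nonempty width
  ... | no ⊤-empty = (λ x → contradiction (x , ∈⊤) ⊤-empty) , λ {x} _ _ _ → contradiction (x , ∈⊤) ⊤-empty

  Dominates : Subset n → Subset n → Set
  Dominates B A = ∣ A ∣ ≡ ∣ B ∣ × (∀ {b} → b ∈ B → ∃ λ a → a ∈ A × a ≼ b)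

  IsFrontier : Pred (Subset n) 0ℓ
  IsFrontier A = IsAntichain A × (∀ {B} → IsAntichain B → Dominates B A → B ≡ A)

  module _ {k} {c : Fin n → Fin k} (chain : IsChainColouring ⊤ c) where

    open Colouring chain

    module _ {A A′} (acA : IsAntichain A) (acA′ : IsAntichain A′) (same : colours A ≡ colours A′) where

      colours-∪ : colours (A ∪ A′) ⊆ colours A
      colours-∪ i∈ with ∈-colours⁻ i∈
      ... | u , u∈A∪A′ , refl with x∈p∪q⁻ A A′ u∈A∪A′
      ...   | inj₁ u∈A  = ∈-colours⁺ u∈A
      ...   | inj₂ u∈A′ = subst (c u ∈_) (sym same) (∈-colours⁺ u∈A′)

      tops-∪-antichain : IsAntichain (tops (A ∪ A′))
      tops-∪-antichain = tops-antichain covered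
        where
        covered : CoveredByFullAntichains (A ∪ A′)
        covered y∈A∪A′ with x∈p∪q⁻ A A′ y∈A∪A′
        ... | inj₁ y∈A  = A , y∈A , p⊆p∪q A′ , acA , colours-∪
        ... | inj₂ y∈A′ = A′ , y∈A′ , q⊆p∪q A A′ , acA′ , λ i∈ → subst (_ ∈_) same (colours-∪ i∈)

      tops-∪-dominates : Dominates (tops (A ∪ A′)) A
      tops-∪-dominates =
        ≤-antisym (colours⊆⇒∣∣≤ ⊆⊤ acA (λ i∈ → colours-tops ⊆⊤ (colours-mono (p⊆p∪q A′) i∈)))
                  (colours⊆⇒∣∣≤ ⊆⊤ tops-∪-antichain (λ i∈ → colours-∪ (colours-mono tops⊆ i∈))) ,
        above-A
        where
        above-A : ∀ {b} → b ∈ tops (A ∪ A′) → ∃ λ a → a ∈ A × a ≼ b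
        above-A b∈B with ∈-colours⁻ (colours-∪ (colours-mono tops⊆ (∈-colours⁺ b∈B)))
        ... | a , a∈A , ca≡cb = a , a∈A , ≼-top (p⊆p∪q A′ a∈A) b∈B ca≡cb

      tops-∪≡ : (∀ {B} → IsAntichain B → Dominates B A → B ≡ A) → tops (A ∪ A′) ≡ A
      tops-∪≡ frontierA = frontierA tops-∪-antichain tops-∪-dominates

    colours-injective : ∀ {A A′} → IsFrontier A → IsFrontier A′ → colours A ≡ colours A′ → A ≡ A′
    colours-injective {A} {A′} (acA , frontierA) (acA′ , frontierA′) same = begin
      A             ≡⟨ tops-∪≡ acA acA′ same frontierA ⟨
      tops (A ∪ A′) ≡⟨ cong tops (∪-comm A A′) ⟩
      tops (A′ ∪ A) ≡⟨ tops-∪≡ acA′ acA (sym same) frontierA′ ⟩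
      A′            ∎
      where open ≡-Reasoning

  frontiers-length≤ : ∀ {k} → WidthAtMost ⊤ k → {L : List (Subset n)} → Unique L → All IsFrontier L →
                      length L ≤ 2 ^ k
  frontiers-length≤ width uniq frontiers with _ , chain ← dilworth width =
    Unique⇒length≤ (subsetToFin ∘ colours)
      (λ A∈L A′∈L → colours-injective chain (All.lookup frontiers A∈L) (All.lookup frontiers A′∈L)
                    ∘ subsetToFin-injective)
      uniq
    where open Colouring chain

open Defs

module _ {n} (E : Graph n) where

  walk⇒star : ∀ {u v vs} → IsWalk E u v vs → Star E u v
  walk⇒star single        = ε
  walk⇒star (step e walk) = e ◅ walk⇒star walk

  reaches⇒star : ∀ {u v} → Reaches E u v → Star E u v
  reaches⇒star (_ , walk , _) = walk⇒star walk

  path-suffix : ∀ {w v vs u} → IsWalk E w v vs → Unique vs → u ∈ₗ vs → Reaches E u v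
  path-suffix single          distinct       (here refl) = _ , single , distinct
  path-suffix (step e walk)   distinct       (here refl) = _ , step e walk , distinct
  path-suffix (step _ walk)   (_ ∷ distinct) (there u∈) = path-suffix walk distinct u∈

  star⇒reaches : ∀ {u v} → Star E u v → Reaches E u v
  star⇒reaches {u} ε = [ u ] , single , All.[] ∷ []
  star⇒reaches {u} (e ◅ s) with vs , walk , distinct ← star⇒reaches s with Any.any? (u ≟ᶠ_) vs
  ... | yes u∈vs = path-suffix walk distinct u∈vs
  ... | no  u∉vs = u ∷ vs , step e walk , ¬Any⇒All¬ vs u∉vs ∷ distinct

  star-antisym : IsDAG E → ∀ {u v} → Star E u v → Star E v u → u ≡ v
  star-antisym dag ε       _  = refl
  star-antisym dag (e ◅ s) s′ = contradiction (star⇒reaches (s ◅◅ s′)) (dag _ _ e)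

-- The edges form an arbitrary family of types, so reachability is not decidable constructively;
-- but the bound to be proved is decidable, so it may be proved assuming reachability decidable.
¬¬-decidable : ∀ {R : Rel (Fin n) 0ℓ} → DoubleNegation (∀ u v → Dec (R u v))
¬¬-decidable = sequence ¬¬-Applicative λ _ → sequence ¬¬-Applicative λ _ → ¬¬-excluded-middle
  where ¬¬-Applicative = RawMonad.rawApplicative ¬¬-Monad

module ReachabilityOrder {n} {E : Graph n} (dag : IsDAG E) (reach? : ∀ u v → Dec (Star E u v)) where

  isDecPartialOrder : IsDecPartialOrder _≡_ (Star E)
  isDecPartialOrder = record
    { isPartialOrder = record { isPreorder = Star.isPreorder E ; antisym = star-antisym E dag }
    ; _≟_            = _≟ᶠ_
    ; _≤?_           = reach?
    }

  module Reach = FinitePoset isDecPartialOrder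

  antichain⁺ : ∀ {A} → IsAntichain E A → Reach.IsAntichain A
  antichain⁺ acA {x} {y} x∈A y∈A x≼y with x ≟ᶠ y
  ... | yes x≡y = x≡y
  ... | no  x≢y = contradiction (star⇒reaches E x≼y) (acA x y x∈A y∈A x≢y)

  antichain⁻ : ∀ {A} → Reach.IsAntichain A → IsAntichain E A
  antichain⁻ acA x y x∈A y∈A x≢y = x≢y ∘ acA x∈A y∈A ∘ reaches⇒star E

  frontier⁺ : ∀ {A} → IsFrontier E A → Reach.IsFrontier A
  frontier⁺ {A} (acA , frontier) = antichain⁺ acA , λ {B} acB (∣A∣≡∣B∣ , above) →
    decidable-stable (≡-dec Bool._≟_ B A) λ B≢A →
      frontier B (antichain⁻ acB) B≢A
        (∣A∣≡∣B∣ , λ _ b∈B → Product.map₂ (Product.map₂ (star⇒reaches E)) (above b∈B))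

  width⁺ : ∀ {k} → (∀ A → IsAntichain E A → ∣ A ∣ ≤ k) → Reach.WidthAtMost ⊤ k
  width⁺ width {A} _ acA = width A (antichain⁻ acA)

  frontiers-length≤ : ∀ {k} → (∀ A → IsAntichain E A → ∣ A ∣ ≤ k) →
                      {L : List (Subset n)} → Unique L → All (IsFrontier E) L → length L ≤ 2 ^ k
  frontiers-length≤ width uniq frontiers =
    Reach.frontiers-length≤ (width⁺ width) uniq (All.map frontier⁺ frontiers)

lemma3 : (n : ℕ) (E : Graph n) (k : ℕ) → IsDAG E → HasWidth E k →
    (L : List (Subset n)) → Unique L → All (IsFrontier E) L →
    length L ≤ 2 ^ k
lemma3 n E k dag (_ , width) L uniq frontiers =
  decidable-stable (length L ≤? 2 ^ k) (¬¬-map bound ¬¬-decidable)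
  where
  bound : (∀ u v → Dec (Star E u v)) → length L ≤ 2 ^ k
  bound reach? = ReachabilityOrder.frontiers-length≤ dag reach? width uniq frontiers
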